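{- Let $m \geq 1$ and $k \geq 2$ be integers, and let $B_m = K_2 + \overline{K_m}$ be the book with $m$ pages. Then $$ gr_{k}(K_{3} : B_{m}) \geq \begin{cases} (R(B_{m}, B_{m}) - 1) \cdot 5^{(k - 2)/2} + 1 & \text{if $k$ is even,}\\ 2 \cdot (R(B_{m}, B_{m}) - 1) \cdot 5^{(k - 3)/2} + 1 & \text{if $k$ is odd.} \end{cases} $$
   Context: The book $B_m = K_2 + \overline{K_m}$ is the graph consisting of an edge $uv$ (the spine) together with $m$ further vertices, each adjacent to both $u$ and $v$ and to nothing else. $R(G,H)$ denotes the 2-color Ramsey number: the least $n$ such that every red/blue edge-coloring of $K_n$ contains a red $G$ or a blue $H$. A coloring is rainbow if no two edges have the same color. The Gallai-Ramsey number $gr_k(K_3 : H)$ is the minimum integer $n$ such that every edge-coloring of $K_n$ using at most $k$ colors contains either a rainbow triangle or a monochromatic copy of $H$. -}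

module Defs where

open import Data.Nat using (ℕ; zero; suc; _+_; _*_; _∸_; _^_; _≤_)
open import Data.Nat.DivMod using (_/_; _%_)
open import Data.Fin using (Fin; zero; suc)
open import Data.Product using (Σ; _×_)
open import Data.Sum using (_⊎_)
open import Relation.Binary.PropositionalEquality using (_≡_; _≢_)

-- Only the values on pairs i ≠ j matter;
-- the colouring is required to be symmetric (edges are unordered).
record Colouring (n k : ℕ) : Set where
  field
    col : Fin n → Fin n → Fin k
    sym : ∀ i j → col i j ≡ col j i
open Colouring public

RainbowTriangle : ∀ {n k} → Colouring n k → Set
RainbowTriangle {n} c =
  Σ (Fin n) λ a → Σ (Fin n) λ b → Σ (Fin n) λ d →
    (a ≢ b) × (b ≢ d) × (a ≢ d) ×
    (col c a b ≢ col c b d) × (col c b d ≢ col c a d) × (col c a b ≢ col c a d)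

-- A copy (not necessarily induced) of the book B_m = K_2 + \overline{K_m}
-- all of whose edges have colour x: spine u v, pages w 0, …, w (m-1),
-- all m+2 vertices distinct.
MonoBook : ∀ {n k} → Colouring n k → (m : ℕ) → Fin k → Set
MonoBook {n} c m x =
  Σ (Fin n) λ u → Σ (Fin n) λ v → Σ (Fin m → Fin n) λ w →
    (u ≢ v) ×
    (∀ i j → w i ≡ w j → i ≡ j) ×
    (∀ i → w i ≢ u) × (∀ i → w i ≢ v) ×
    (col c u v ≡ x) × (∀ i → col c u (w i) ≡ x) × (∀ i → col c v (w i) ≡ x)

IsLeast : (ℕ → Set) → ℕ → Set
IsLeast P n = P n × (∀ n′ → P n′ → n ≤ n′)

RamseyBookProp : ℕ → ℕ → Set
RamseyBookProp m n = ∀ (c : Colouring n 2) → MonoBook c m zero ⊎ MonoBook c m (suc zero)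

GallaiRamseyBookProp : ℕ → ℕ → ℕ → Set
GallaiRamseyBookProp k m n =
  ∀ (c : Colouring n k) → RainbowTriangle c ⊎ Σ (Fin k) (λ x → MonoBook c m x)

IsRamseyBook : ℕ → ℕ → Set
IsRamseyBook m r = IsLeast (RamseyBookProp m) r

IsGallaiRamseyBook : ℕ → ℕ → ℕ → Set
IsGallaiRamseyBook k m g = IsLeast (GallaiRamseyBookProp k m) g

grBound : ℕ → ℕ → ℕ
grBound k r with k % 2
... | zero  = (r ∸ 1) * 5 ^ ((k ∸ 2) / 2) + 1
... | suc _ = 2 * (r ∸ 1) * 5 ^ ((k ∸ 3) / 2) + 1

module Submission where

-- The construction of the paper, read contrapositively (which avoids having
-- to exhibit a colouring of K_{r-1} without monochromatic book).
--
-- A k-colouring of K_N is *book-reflecting for Q* if it has no rainbow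
-- triangle and each of its monochromatic copies of B_m yields a proof of Q.
-- Substituting a book-reflecting colouring A of K_a into every vertex of a
-- rainbow-free colouring T of K_b without monochromatic triangle (with the
-- colours of A kept apart from those of T) gives a book-reflecting colouring
-- of K_{b·a}: the spine and first page of a monochromatic book cannot span
-- two copies of A, since they would give a monochromatic triangle of T, so
-- the whole book lies in a single copy of A.
--
-- Start from an arbitrary red/blue colouring c of K_{r-1} (Q = "c contains a
-- monochromatic B_m"), substitute it into a one-coloured K_2 if k is odd, and
-- then j times into the 2-coloured K_5 without monochromatic triangle.  This
-- yields a book-reflecting colouring of K_N with k colours, N + 1 = grBound k r.
-- If gr_k(K_3 : B_m) ≤ N, restricting it to gr_k vertices shows that every c
-- contains a monochromatic B_m, i.e. R(B_m,B_m) ≤ r − 1: a contradiction.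

open import Defs hiding (sym)
open import Data.Nat using (ℕ; zero; suc; _+_; _*_; _∸_; _^_; _≤_; _<_; s≤s; z≤n; _≤?_)
open import Data.Nat.Properties using (≰⇒>; 1+n≰n; *-identityˡ; *-assoc; *-comm; +-comm; m+n∸n≡m)
open import Data.Nat.DivMod using (_/_; _%_; [m+kn]%n≡m%n; m*n/n≡m)
open import Data.Fin using (Fin; zero; suc; toℕ; _↑ˡ_; _↑ʳ_; splitAt; remQuot; combine; inject≤)
open import Data.Fin.Properties
  using (splitAt-↑ˡ; splitAt-↑ʳ; combine-remQuot; inject≤-injective; ↑ˡ-injective; ↑ʳ-injective; all?; _≟_)
open import Data.Product using (Σ; _×_; _,_; proj₁; proj₂)
open import Data.Sum using (_⊎_; inj₁; inj₂)
open import Data.Empty using (⊥; ⊥-elim)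
open import Data.Unit using (tt)
open import Relation.Nullary using (¬_; Dec; yes; no)
open import Relation.Nullary.Decidable using (¬?; _×-dec_; toWitness)
open import Relation.Binary.PropositionalEquality
  using (_≡_; _≢_; refl; sym; trans; cong; cong₂; subst; module ≡-Reasoning)

MonochromaticTriangle : ∀ {n k} → Colouring n k → Set
MonochromaticTriangle {n} c =
  Σ (Fin n) λ a → Σ (Fin n) λ b → Σ (Fin n) λ d →
    (a ≢ b) × (b ≢ d) × (a ≢ d) × (col c a b ≡ col c a d) × (col c a b ≡ col c b d)

RedOrBlueBook : ∀ {n} → Colouring n 2 → ℕ → Set
RedOrBlueBook c m = MonoBook c m zero ⊎ MonoBook c m (suc zero)

noTriangleIn2 : (a b d : Fin 2) → a ≢ b → b ≢ d → a ≢ d → ⊥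
noTriangleIn2 zero       zero       _          a≢b _   _   = a≢b refl
noTriangleIn2 (suc zero) (suc zero) _          a≢b _   _   = a≢b refl
noTriangleIn2 zero       (suc zero) zero       _   _   a≢d = a≢d refl
noTriangleIn2 zero       (suc zero) (suc zero) _   b≢d _   = b≢d refl
noTriangleIn2 (suc zero) zero       zero       _   b≢d _   = b≢d refl
noTriangleIn2 (suc zero) zero       (suc zero) _   _   a≢d = a≢d refl

twoColouring-rainbowFree : ∀ {n} (c : Colouring n 2) → ¬ RainbowTriangle c
twoColouring-rainbowFree c (a , b , d , _ , _ , _ , ≢₁ , ≢₂ , ≢₃) =
  noTriangleIn2 (col c a b) (col c b d) (col c a d) ≢₁ ≢₂ ≢₃

↑ˡ≢↑ʳ : ∀ {q p} (x : Fin q) (y : Fin p) → x ↑ˡ p ≢ q ↑ʳ y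
↑ˡ≢↑ʳ {q} {p} x y eq with trans (sym (splitAt-↑ˡ q x p)) (trans (cong (splitAt q) eq) (splitAt-↑ʳ q p y))
... | ()

record BookReflecting (N k m : ℕ) (Q : Set) : Set where
  field
    colouring   : Colouring N k
    rainbowFree : ¬ RainbowTriangle colouring
    reflectBook : ∀ x → MonoBook colouring m x → Q
open BookReflecting

selfReflecting : ∀ {s m} (c : Colouring s 2) → BookReflecting s 2 m (RedOrBlueBook c m)
selfReflecting c = record
  { colouring = c ; rainbowFree = twoColouring-rainbowFree c ; reflectBook = reflect }
  where
  reflect : ∀ x → MonoBook c _ x → RedOrBlueBook c _
  reflect zero       book = inj₁ book
  reflect (suc zero) book = inj₂ book

pullback : ∀ {n N k m Q} (f : Fin n → Fin N) → (∀ i j → f i ≡ f j → i ≡ j) →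
           BookReflecting N k m Q → BookReflecting n k m Q
pullback {n} {N} {k} {m} {Q} f f-inj R = record
  { colouring = induced ; rainbowFree = noRainbow ; reflectBook = reflect }
  where
  C : Colouring N k
  C = colouring R
  induced : Colouring n k
  induced = record { col = λ i j → col C (f i) (f j) ; sym = λ i j → Colouring.sym C (f i) (f j) }
  f-≢ : ∀ {i j} → i ≢ j → f i ≢ f j
  f-≢ i≢j e = i≢j (f-inj _ _ e)
  noRainbow : ¬ RainbowTriangle induced
  noRainbow (a , b , d , a≢b , b≢d , a≢d , colours) =
    rainbowFree R (f a , f b , f d , f-≢ a≢b , f-≢ b≢d , f-≢ a≢d , colours)
  reflect : ∀ x → MonoBook induced m x → Q
  reflect x (u , v , w , u≢v , w-inj , w≢u , w≢v , colours) =
    reflectBook R x (f u , f v , (λ i → f (w i)) , f-≢ u≢v ,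
      (λ i j e → w-inj i j (f-inj _ _ e)) , (λ i → f-≢ (w≢u i)) , (λ i → f-≢ (w≢v i)) , colours)

restrict : ∀ {n N k m Q} → n ≤ N → BookReflecting N k m Q → BookReflecting n k m Q
restrict n≤N = pullback (λ i → inject≤ i n≤N) (inject≤-injective n≤N n≤N)

gallai-forces : ∀ {n k m Q} → GallaiRamseyBookProp k m n → BookReflecting n k m Q → Q
gallai-forces gallai R with gallai (colouring R)
... | inj₁ rainbow       = ⊥-elim (rainbowFree R rainbow)
... | inj₂ (x , book)    = reflectBook R x book

module Substitution {b q a p : ℕ} (T : Colouring b q) (A : Colouring a p) where

  -- Vertex v of K_{b·a} is vertex `inner v` of the copy of A at `block v`.
  block : Fin (b * a) → Fin b
  block v = proj₁ (remQuot {b} a v)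

  inner : Fin (b * a) → Fin a
  inner v = proj₂ (remQuot {b} a v)

  vertex-≡ : ∀ v v' → block v ≡ block v' → inner v ≡ inner v' → v ≡ v'
  vertex-≡ v v' e₁ e₂ =
    trans (sym (combine-remQuot {b} a v)) (trans (cong₂ combine e₁ e₂) (combine-remQuot {b} a v'))

  inner-≢ : ∀ {v v'} → block v ≡ block v' → v ≢ v' → inner v ≢ inner v'
  inner-≢ e v≢v' e' = v≢v' (vertex-≡ _ _ e e')

  edgeColour : Fin b → Fin b → Fin a → Fin a → Fin (q + p)
  edgeColour i i' j j' with i ≟ i'
  ... | yes _ = q ↑ʳ col A j j'
  ... | no _  = col T i i' ↑ˡ p

  colour : Fin (b * a) → Fin (b * a) → Fin (q + p)
  colour v v' = edgeColour (block v) (block v') (inner v) (inner v')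

  within : ∀ {i i'} j j' → i ≡ i' → edgeColour i i' j j' ≡ q ↑ʳ col A j j'
  within {i} {i'} j j' i≡i' with i ≟ i'
  ... | yes _   = refl
  ... | no i≢i' = ⊥-elim (i≢i' i≡i')

  between : ∀ {i i'} j j' → i ≢ i' → edgeColour i i' j j' ≡ col T i i' ↑ˡ p
  between {i} {i'} j j' i≢i' with i ≟ i'
  ... | yes i≡i' = ⊥-elim (i≢i' i≡i')
  ... | no _     = refl

  module _ {v v' w w' : Fin (b * a)} where
    within-≡ : block v ≡ block v' → block w ≡ block w' →
               col A (inner v) (inner v') ≡ col A (inner w) (inner w') → colour v v' ≡ colour w w'
    within-≡ e₁ e₂ eq = trans (within _ _ e₁) (trans (cong (q ↑ʳ_) eq) (sym (within _ _ e₂)))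

    within-≡⁻¹ : block v ≡ block v' → block w ≡ block w' →
                 colour v v' ≡ colour w w' → col A (inner v) (inner v') ≡ col A (inner w) (inner w')
    within-≡⁻¹ e₁ e₂ eq = ↑ʳ-injective q _ _ (trans (sym (within _ _ e₁)) (trans eq (within _ _ e₂)))

    between-≡ : block v ≢ block v' → block w ≢ block w' →
                col T (block v) (block v') ≡ col T (block w) (block w') → colour v v' ≡ colour w w'
    between-≡ n₁ n₂ eq = trans (between _ _ n₁) (trans (cong (_↑ˡ p) eq) (sym (between _ _ n₂)))

    between-≡⁻¹ : block v ≢ block v' → block w ≢ block w' →
                  colour v v' ≡ colour w w' → col T (block v) (block v') ≡ col T (block w) (block w')
    between-≡⁻¹ n₁ n₂ eq = ↑ˡ-injective p _ _ (trans (sym (between _ _ n₁)) (trans eq (between _ _ n₂)))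

  colour-sym : ∀ v v' → colour v v' ≡ colour v' v
  colour-sym v v' = bySameBlock (block v ≟ block v')
    where
    bySameBlock : Dec (block v ≡ block v') → colour v v' ≡ colour v' v
    bySameBlock (yes e) = within-≡ e (sym e) (Colouring.sym A _ _)
    bySameBlock (no n)  = between-≡ n (λ e → n (sym e)) (Colouring.sym T _ _)

  S : Colouring (b * a) (q + p)
  S = record { col = colour ; sym = colour-sym }

  fromOutside : ∀ {x y z} → block x ≢ block y → block y ≡ block z → colour x y ≡ colour x z
  fromOutside x≢y y≡z = between-≡ x≢y (λ e → x≢y (trans e (sym y≡z))) (cong (col T _) y≡z)

  rainbowFree-S : ¬ RainbowTriangle T → ¬ RainbowTriangle A → ¬ RainbowTriangle S
  rainbowFree-S noT noA (x , y , z , x≢y , y≢z , x≢z , ≢₁ , ≢₂ , ≢₃) =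
    cases (block x ≟ block y) (block y ≟ block z) (block x ≟ block z)
    where
    cases : Dec (block x ≡ block y) → Dec (block y ≡ block z) → Dec (block x ≡ block z) → ⊥
    cases (yes xy) (yes yz) _ = noA (inner x , inner y , inner z ,
      inner-≢ xy x≢y , inner-≢ yz y≢z , inner-≢ xz x≢z ,
      (λ e → ≢₁ (within-≡ xy yz e)) , (λ e → ≢₂ (within-≡ yz xz e)) , (λ e → ≢₃ (within-≡ xy xz e)))
      where xz = trans xy yz
    cases (yes xy) (no yz) _ =
      ≢₂ (trans (colour-sym y z) (trans (fromOutside (λ e → yz (sym e)) (sym xy)) (colour-sym z x)))
    cases (no xy) (yes yz) _ = ≢₃ (fromOutside xy yz)
    cases (no xy) (no yz) (yes xz) =
      ≢₁ (trans (colour-sym x y) (fromOutside (λ e → xy (sym e)) xz))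
    cases (no xy) (no yz) (no xz) = noT (block x , block y , block z , xy , yz , xz ,
      (λ e → ≢₁ (between-≡ xy yz e)) , (λ e → ≢₂ (between-≡ yz xz e)) , (λ e → ≢₃ (between-≡ xy xz e)))

  inside : ∀ {v v' y} → colour v v' ≡ q ↑ʳ y → block v ≡ block v'
  inside {v} {v'} eq = bySameBlock (block v ≟ block v')
    where
    bySameBlock : Dec (block v ≡ block v') → block v ≡ block v'
    bySameBlock (yes e) = e
    bySameBlock (no n)  = ⊥-elim (↑ˡ≢↑ʳ _ _ (trans (sym (between _ _ n)) eq))

  across : ∀ {v v' x} → colour v v' ≡ x ↑ˡ p → block v ≢ block v'
  across eq e = ↑ˡ≢↑ʳ _ _ (trans (sym eq) (within _ _ e))

  acrossTriangle : ∀ {u v w} → block u ≢ block v →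
                   colour u w ≡ colour u v → colour v w ≡ colour u v → MonochromaticTriangle T
  acrossTriangle {u} {v} {w} uv uw≡uv vw≡uv =
    block u , block v , block w , uv , vw , uw ,
    between-≡⁻¹ uv uw (sym uw≡uv) , between-≡⁻¹ uv vw (sym vw≡uv)
    where
    uw : block u ≢ block w
    uw = across (trans uw≡uv (between _ _ uv))
    vw : block v ≢ block w
    vw = across (trans vw≡uv (between _ _ uv))

  reflectBook-S : ∀ {m} {Q : Set} → ¬ MonochromaticTriangle T →
                  (∀ x → MonoBook A (suc m) x → Q) → ∀ x → MonoBook S (suc m) x → Q
  reflectBook-S {m} {Q} noMono reflectA x (u , v , w , u≢v , w-inj , w≢u , w≢v , uv≡x , uw≡x , vw≡x)
    = bySpine (block u ≟ block v)
    where
    bySpine : Dec (block u ≡ block v) → Q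
    bySpine (no uv)  =
      ⊥-elim (noMono (acrossTriangle uv (trans (uw≡x zero) (sym uv≡x)) (trans (vw≡x zero) (sym uv≡x))))
    bySpine (yes uv) = reflectA (col A (inner u) (inner v)) (inner u , inner v , (λ i → inner (w i)) ,
        inner-≢ uv u≢v ,
        (λ i j e → w-inj i j (vertex-≡ (w i) (w j) (trans (page i) (sym (page j))) e)) ,
        (λ i → inner-≢ (page i) (w≢u i)) ,
        (λ i → inner-≢ (trans (page i) uv) (w≢v i)) ,
        refl ,
        (λ i → within-≡⁻¹ (sym (page i)) uv (trans (uw≡x i) (sym uv≡x))) ,
        (λ i → within-≡⁻¹ (trans (sym uv) (sym (page i))) uv (trans (vw≡x i) (sym uv≡x))))
      where
      page : ∀ i → block (w i) ≡ block u
      page i = sym (inside (trans (uw≡x i) (trans (sym uv≡x) (within _ _ uv))))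

substitute : ∀ {b q a p m Q} (T : Colouring b q) → ¬ RainbowTriangle T → ¬ MonochromaticTriangle T →
             BookReflecting a p (suc m) Q → BookReflecting (b * a) (q + p) (suc m) Q
substitute T noRainbow noMono R = record
  { colouring   = S
  ; rainbowFree = rainbowFree-S noRainbow (rainbowFree R)
  ; reflectBook = reflectBook-S noMono (reflectBook R) }
  where open Substitution T (colouring R)

singleEdge : Colouring 2 1
singleEdge = record { col = λ _ _ → zero ; sym = λ _ _ → refl }

singleEdge-rainbowFree : ¬ RainbowTriangle singleEdge
singleEdge-rainbowFree (_ , _ , _ , _ , _ , _ , ≢₁ , _) = ≢₁ refl

singleEdge-monoFree : ¬ MonochromaticTriangle singleEdge
singleEdge-monoFree (a , b , d , a≢b , b≢d , a≢d , _) = noTriangleIn2 a b d a≢b b≢d a≢d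

-- K_5 on ℤ/5 with the 5-cycle i ~ i ± 1 red and its complement (again a
-- 5-cycle) blue: the unique 2-colouring of K_5 without monochromatic triangle.
pentagon : Colouring 5 2
pentagon = record { col = colour ; sym = colour-sym }
  where
  onCycle : ℕ → Fin 2
  onCycle 1 = zero
  onCycle 4 = zero
  onCycle _ = suc zero
  colour : Fin 5 → Fin 5 → Fin 2
  colour i j = onCycle ((5 + toℕ i ∸ toℕ j) % 5)
  colour-sym : ∀ i j → colour i j ≡ colour j i
  colour-sym = toWitness {a? = all? (λ i → all? (λ j → colour i j ≟ colour j i))} tt

pentagon-monoFree : ¬ MonochromaticTriangle pentagon
pentagon-monoFree (a , b , d , rest) = toWitness {a? = check} tt a b d rest
  where
  c : Fin 5 → Fin 5 → Fin 2
  c = col pentagon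
  check : Dec (∀ a b d → ¬ (a ≢ b × b ≢ d × a ≢ d × c a b ≡ c a d × c a b ≡ c b d))
  check = all? λ a → all? λ b → all? λ d →
    ¬? (¬? (a ≟ b) ×-dec ¬? (b ≟ d) ×-dec ¬? (a ≟ d) ×-dec c a b ≟ c a d ×-dec c a b ≟ c b d)

pentagonTower : ∀ {N k m Q} j → BookReflecting N k (suc m) Q → BookReflecting (5 ^ j * N) (j * 2 + k) (suc m) Q
pentagonTower {N} {k} {m} {Q} zero R = subst (λ n → BookReflecting n k (suc m) Q) (sym (*-identityˡ N)) R
pentagonTower {N} {k} {m} {Q} (suc j) R =
  subst (λ n → BookReflecting n (2 + (j * 2 + k)) (suc m) Q) (sym (*-assoc 5 (5 ^ j) N))
    (substitute pentagon (twoColouring-rainbowFree pentagon) pentagon-monoFree (pentagonTower j R))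

doubled : ∀ {N k m Q} → BookReflecting N k (suc m) Q → BookReflecting (2 * N) (1 + k) (suc m) Q
doubled = substitute singleEdge singleEdge-rainbowFree singleEdge-monoFree

-- R(B_m,B_m) = r is not attained below r; for r = 0 because the empty
-- colouring contains no book.
ramsey-minimal : ∀ {m r} → IsRamseyBook m r → ¬ RamseyBookProp m (r ∸ 1)
ramsey-minimal {r = zero} (holds , _) _ with holds (record { col = λ () ; sym = λ () })
... | inj₁ (() , _)
... | inj₂ (() , _)
ramsey-minimal {r = suc r} (_ , least) holds = 1+n≰n (least r holds)

gallai-exceeds : ∀ {m k r g N} → IsRamseyBook m r → GallaiRamseyBookProp k m g →
                 ((c : Colouring (r ∸ 1) 2) → BookReflecting N k m (RedOrBlueBook c m)) → N < g
gallai-exceeds {g = g} {N} ramsey gallai lift with g ≤? N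
... | yes g≤N = ⊥-elim (ramsey-minimal ramsey (λ c → gallai-forces gallai (restrict g≤N (lift c))))
... | no g≰N  = ≰⇒> g≰N

data Parity≥2 : ℕ → Set where
  even : ∀ j → Parity≥2 (j * 2 + 2)
  odd  : ∀ j → Parity≥2 (j * 2 + 3)

parity≥2 : ∀ k → 2 ≤ k → Parity≥2 k
parity≥2 (suc zero) (s≤s ())
parity≥2 (suc (suc zero)) _ = even 0
parity≥2 (suc (suc (suc zero))) _ = odd 0
parity≥2 (suc (suc (suc (suc k)))) _ = plusTwo (parity≥2 (suc (suc k)) (s≤s (s≤s z≤n)))
  where
  plusTwo : ∀ {n} → Parity≥2 n → Parity≥2 (2 + n)
  plusTwo (even j) = even (suc j)
  plusTwo (odd j)  = odd (suc j)

grBound-even : ∀ j r → grBound (j * 2 + 2) r ≡ suc (5 ^ j * (r ∸ 1))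
grBound-even j r with (j * 2 + 2) % 2 | trans (cong (_% 2) (+-comm (j * 2) 2)) ([m+kn]%n≡m%n 2 j 2)
... | .0 | refl = begin
  (r ∸ 1) * 5 ^ ((j * 2 + 2 ∸ 2) / 2) + 1 ≡⟨ cong (λ e → (r ∸ 1) * 5 ^ (e / 2) + 1) (m+n∸n≡m (j * 2) 2) ⟩
  (r ∸ 1) * 5 ^ (j * 2 / 2) + 1           ≡⟨ cong (λ e → (r ∸ 1) * 5 ^ e + 1) (m*n/n≡m j 2) ⟩
  (r ∸ 1) * 5 ^ j + 1                     ≡⟨ +-comm _ 1 ⟩
  suc ((r ∸ 1) * 5 ^ j)                   ≡⟨ cong suc (*-comm (r ∸ 1) (5 ^ j)) ⟩
  suc (5 ^ j * (r ∸ 1))                   ∎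
  where open ≡-Reasoning

grBound-odd : ∀ j r → grBound (j * 2 + 3) r ≡ suc (5 ^ j * (2 * (r ∸ 1)))
grBound-odd j r with (j * 2 + 3) % 2 | trans (cong (_% 2) (+-comm (j * 2) 3)) ([m+kn]%n≡m%n 3 j 2)
... | .1 | refl = begin
  2 * (r ∸ 1) * 5 ^ ((j * 2 + 3 ∸ 3) / 2) + 1 ≡⟨ cong (λ e → 2 * (r ∸ 1) * 5 ^ (e / 2) + 1) (m+n∸n≡m (j * 2) 3) ⟩
  2 * (r ∸ 1) * 5 ^ (j * 2 / 2) + 1           ≡⟨ cong (λ e → 2 * (r ∸ 1) * 5 ^ e + 1) (m*n/n≡m j 2) ⟩
  2 * (r ∸ 1) * 5 ^ j + 1                     ≡⟨ +-comm _ 1 ⟩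
  suc (2 * (r ∸ 1) * 5 ^ j)                   ≡⟨ cong suc (*-comm (2 * (r ∸ 1)) (5 ^ j)) ⟩
  suc (5 ^ j * (2 * (r ∸ 1)))                 ∎
  where open ≡-Reasoning

theorem3p1 : ∀ (m k : ℕ) → 1 ≤ m → 2 ≤ k →
    ∀ (r g : ℕ) → IsRamseyBook m r → IsGallaiRamseyBook k m g →
    grBound k r ≤ g
theorem3p1 (suc m) k (s≤s z≤n) 2≤k r g ramsey (gallai , _) with parity≥2 k 2≤k
... | even j = subst (_≤ g) (sym (grBound-even j r))
      (gallai-exceeds ramsey gallai (λ c → pentagonTower j (selfReflecting c)))
... | odd j  = subst (_≤ g) (sym (grBound-odd j r))
      (gallai-exceeds ramsey gallai (λ c → pentagonTower j (doubled (selfReflecting c))))
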